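{- Let $b,c,d$ be positive integers. (1) Every set in $\mathrm{GC}(b,c,d)$ is finite if and only if $d>b$ or $d>c$. (2) If $d\leq b$ and $d\leq c$, then $\mathrm{GC}(b,c,d)$ is nontrivial.
   Context: Sets are languages over $\Sigma=\{0,1\}$; FP is the class of polynomial-time computable functions. For positive integers $b,c,d$, $\mathrm{GC}(b,c,d)$ is the class of sets $L$ for which there is an FP function $f$ such that for every $n\geq1$ and all distinct strings $y_1,\dots,y_n$ (given as a tuple in lexicographic order): $f(y_1,\dots,y_n)\subseteq\{y_1,\dots,y_n\}$, $\|f(y_1,\dots,y_n)\|\leq c$, and if $\|L\cap\{y_1,\dots,y_n\}\|\geq b$ then $\|L\cap f(y_1,\dots,y_n)\|\geq d$. A class of sets is nontrivial if it contains some infinite set but does not contain all subsets of $\Sigma^*$. -}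

module Defs where

open import Data.Bool using (Bool; true; false)
open import Data.Nat using (ℕ; zero; suc; _+_; _*_; _^_; _≤_)
open import Data.Fin using (Fin; zero; suc)
open import Data.List using (List; []; _∷_; _++_; concatMap; length)
open import Data.List.Membership.Propositional using (_∈_)
open import Data.List.Relation.Binary.Subset.Propositional using (_⊆_)
open import Data.List.Relation.Unary.All using (All)
open import Data.List.Relation.Unary.Unique.Propositional using (Unique)
open import Data.List.Relation.Unary.Linked using (Linked)
open import Data.Maybe using (Maybe; just; nothing)
open import Data.Product using (Σ; _×_; _,_)
open import Relation.Binary.PropositionalEquality using (_≡_; _≢_)
open import Relation.Nullary using (¬_)

-- Strings and languages over Σ = {0,1}  (false = 0, true = 1)

Str : Set
Str = List Bool

Language : Set₁
Language = Str → Set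

Finite : Language → Set
Finite L = Σ (List Str) λ xs → ∀ w → L w → w ∈ xs

Infinite : Language → Set
Infinite L = ¬ Finite L

Nontrivial : (Language → Set) → Set₁
Nontrivial C = (Σ Language λ L → C L × Infinite L) × ¬ (∀ L → C L)

data _<ₗ_ : Str → Str → Set where
  []<∷  : ∀ {b w} → [] <ₗ (b ∷ w)
  0<1   : ∀ {u v} → (false ∷ u) <ₗ (true ∷ v)
  tail< : ∀ {b u v} → u <ₗ v → (b ∷ u) <ₗ (b ∷ v)

-- Deterministic single-tape Turing machines (two-way infinite tape).
-- Tape alphabet Fin (3 + k): zero = blank, 1 = bit 0, 2 = bit 1, rest extra.

data Move : Set where
  left right stay : Move

record TM : Set where
  field
    nstates : ℕ                    -- states are Fin (suc nstates); start = zero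
    extra   : ℕ
    δ : Fin (suc nstates) → Fin (3 + extra) →
        Maybe (Fin (suc nstates) × Fin (3 + extra) × Move)   -- nothing = halt

module _ (M : TM) where
  open TM M

  Sym : Set
  Sym = Fin (3 + extra)

  blank : Sym
  blank = zero

  bitSym : Bool → Sym
  bitSym false = suc zero
  bitSym true  = suc (suc zero)

  -- state, tape left of head (nearest first), scanned symbol, tape right of head
  record Config : Set where
    constructor cfg
    field
      state : Fin (suc nstates)
      lft   : List Sym
      head  : Sym
      rgt   : List Sym

  initial : Str → Config
  initial []      = cfg zero [] blank []
  initial (x ∷ xs) = cfg zero [] (bitSym x) (Data.List.map bitSym xs)

  doMove : Move → Fin (suc nstates) → List Sym → Sym → List Sym → Config
  doMove left  q []      s r = cfg q [] blank (s ∷ r)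
  doMove left  q (a ∷ l) s r = cfg q l a (s ∷ r)
  doMove right q l s []      = cfg q (s ∷ l) blank []
  doMove right q l s (a ∷ r) = cfg q (s ∷ l) a r
  doMove stay  q l s r       = cfg q l s r

  step : Config → Maybe Config
  step (cfg q l h r) with δ q h
  ... | nothing            = nothing
  ... | just (q' , s , m)  = just (doMove m q' l s r)

  runFor : ℕ → Config → Maybe Config
  runFor t c with step c
  runFor t       c | nothing = just c
  runFor zero    c | just _  = nothing
  runFor (suc t) c | just c' = runFor t c'

  readBits : List Sym → Str
  readBits []                        = []
  readBits (suc zero ∷ r)            = false ∷ readBits r
  readBits (suc (suc zero) ∷ r)      = true ∷ readBits r
  readBits (_ ∷ r)                   = []

  output : Config → Str
  output (cfg _ _ h r) = readBits (h ∷ r)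

ComputesIn : TM → (ℕ → ℕ) → (Str → Str) → Set
ComputesIn M T f = ∀ x → Σ (Config M) λ c →
  (runFor M (T (length x)) (initial M x) ≡ just c) × (output M c ≡ f x)

-- FP: computable in time k * n ^ k + k for some k (covers every polynomial)
FP : (Str → Str) → Set
FP f = Σ TM λ M → Σ ℕ λ k → ComputesIn M (λ n → k * n ^ k + k) f

encTuple : List Str → Str
encTuple ys = concatMap (λ y → concatMap (λ a → a ∷ a ∷ []) y ++ (false ∷ true ∷ [])) ys

decAux : List Bool → Str → Maybe (List Str)
decAux []      []                    = just []
decAux (_ ∷ _) []                    = nothing
decAux acc     (_ ∷ [])              = nothing
decAux acc     (false ∷ false ∷ r)   = decAux (false ∷ acc) r
decAux acc     (true ∷ true ∷ r)     = decAux (true ∷ acc) r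
decAux acc     (false ∷ true ∷ r)    = Data.Maybe.map (Data.List.reverse acc ∷_) (decAux [] r)
decAux acc     (true ∷ false ∷ r)    = nothing

decTuple : Str → Maybe (List Str)
decTuple = decAux []

AtLeast : ℕ → Language → List Str → Set
AtLeast k L S = Σ (List Str) λ ws → Unique ws × (k ≤ length ws) × All L ws × (ws ⊆ S)

CardAtMost : ℕ → List Str → Set
CardAtMost k S = ∀ ws → Unique ws → ws ⊆ S → length ws ≤ k

GC : ℕ → ℕ → ℕ → Language → Set
GC b c d L = Σ (Str → Str) λ f → FP f × (∀ (ys : List Str) → ys ≢ [] → Linked _<ₗ_ ys →
  Σ (List Str) λ zs → (decTuple (f (encTuple ys)) ≡ just zs)
    × (zs ⊆ ys) × CardAtMost c zs × (AtLeast b L ys → AtLeast d L zs))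

-- An infinite L in GC(b,c,d) yields b of its strings in lexicographic order; the selector must
-- return d strings of L among at most c of these b, hence d ≤ b and d ≤ c.  Since Infinite L
-- is only ¬ Finite L, the b strings exist under a double negation, which suffices here.
-- Conversely, when d ≤ b and d ≤ c the set of all strings is in GC(b,c,d): a linear-time
-- machine scans the doubled-bit encoding, counts separators, blanks the tape after the d-th
-- string and walks back.  Not every set is in GC(b,c,d): enumerate all clocked machines and
-- reserve for the n-th one a block of b + c strings 1ⁿ01ⁱ; the diagonal set contains exactly
-- the strings of each block that its machine does not select, so at least b strings of the
-- block are in it while none of the at most c selected ones is.

module Submission where

open import Defs
open import Data.Bool using (Bool; true; false)
import Data.Bool.Properties as Bool
open import Data.Fin using (Fin; zero; suc; fromℕ; inject₁; opposite; toℕ; _↑ˡ_; _↑ʳ_; splitAt)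
open import Data.Fin.Properties using (splitAt-↑ˡ; splitAt-↑ʳ; opposite-involutive; toℕ-inject₁; toℕ-fromℕ)
open import Data.List
  using (List; []; _∷_; length; map; _++_; _ʳ++_; concat; concatMap; take; drop; filter; replicate; applyUpTo)
open import Data.List.Properties
  using ( ≡-dec; ∷-injectiveʳ; length-removeAt′; map-cong; map-ʳ++; ʳ++-ʳ++; length-ʳ++; length-take
        ; take++drop≡id; length-++-≤ˡ; length-++-≤ʳ; length-applyUpTo)
open import Data.List.Membership.Propositional using (_∈_; _∉_; _─_)
open import Data.List.Membership.Propositional.Properties using (∈-applyUpTo⁻)
open import Data.List.Membership.DecPropositional using (_∈?_)
open import Data.List.Relation.Unary.Any using (here; there; index)
open import Data.List.Relation.Unary.All as All using (All; []; _∷_)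
open import Data.List.Relation.Unary.All.Properties using (all-filter)
open import Data.List.Relation.Unary.AllPairs as AllPairs using ([]; _∷_)
open import Data.List.Relation.Unary.Unique.Propositional using (Unique)
import Data.List.Relation.Unary.Unique.Propositional.Properties as Unique
open import Data.List.Relation.Unary.Linked using (Linked; []; [-]; _∷_)
open import Data.List.Relation.Unary.Linked.Properties using (Linked⇒AllPairs; applyUpTo⁺₂)
open import Data.List.Relation.Binary.Subset.Propositional using (_⊆_)
open import Data.List.Relation.Binary.Subset.Propositional.Properties using (filter-⊆; xs⊆xs++ys)
open import Data.Maybe using (Maybe; just; nothing; fromMaybe)
import Data.Maybe as Maybe
import Data.Maybe.Properties as Maybe
open import Data.Nat using (ℕ; zero; suc; _+_; _*_; _^_; _≤_; _<_; _⊓_; z≤n; s≤s; _≤?_)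
open import Data.Nat.Properties
  using ( ≤-refl; ≤-trans; ≤-reflexive; +-suc; +-comm; +-identityʳ; +-mono-≤; +-monoˡ-≤; +-cancelʳ-≤
        ; *-monoʳ-≤; m≤m*n; m⊓n≤m; m≤n⇒m⊓n≡m; 1+n≰n; <⇒≱; ≰⇒>; module ≤-Reasoning)
open import Data.Nat.Tactic.RingSolver using (solve-∀)
open import Data.Product using (∃-syntax; _×_; _,_; proj₁; proj₂)
import Data.Product as Product
open import Data.Sum using (_⊎_; inj₁; inj₂; [_,_])
open import Data.Unit using (tt)
open import Effect.Monad using (RawMonad)
open import Function using (_∘_; id)
open import Function.Bundles using (_⇔_; mk⇔)
open import Function.Definitions using (StrictlySurjective)
open import Level using (0ℓ)
open import Relation.Binary.Definitions using (Tri; tri<; tri≈; tri>; Trichotomous)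
open import Relation.Binary.PropositionalEquality
  using (_≡_; _≢_; refl; sym; trans; cong; cong₂; subst; module ≡-Reasoning)
open import Relation.Nullary using (¬_; Dec; yes; no; does; contradiction)
open import Relation.Nullary.Decidable using (decidable-stable)
open import Relation.Nullary.Negation using (¬¬-Monad)
open import Relation.Unary using (Decidable; U)
open import Relation.Unary.Properties using (∁?)

module _ {A : Set} where

  ∈-─ : ∀ {x v : A} {ys} (x∈ys : x ∈ ys) → v ∈ ys → v ≢ x → v ∈ ys ─ x∈ys
  ∈-─ (here refl)  (here refl)  v≢x = contradiction refl v≢x
  ∈-─ (here refl)  (there v∈ys) _   = v∈ys
  ∈-─ (there _)    (here refl)  _   = here refl
  ∈-─ (there x∈ys) (there v∈ys) v≢x = there (∈-─ x∈ys v∈ys v≢x)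

  Unique-⊆⇒length≤ : ∀ {ws ys : List A} → Unique ws → ws ⊆ ys → length ws ≤ length ys
  Unique-⊆⇒length≤ {[]}           _            _     = z≤n
  Unique-⊆⇒length≤ {w ∷ ws} {ys} (w∉ws ∷ ws!) ws⊆ys = begin
    suc (length ws)          ≤⟨ s≤s (Unique-⊆⇒length≤ ws! ws⊆ys─w) ⟩
    suc (length (ys ─ w∈ys)) ≡⟨ length-removeAt′ ys (index w∈ys) ⟨
    length ys                ∎
    where
    open ≤-Reasoning
    w∈ys : w ∈ ys
    w∈ys = ws⊆ys (here refl)
    ws⊆ys─w : ws ⊆ ys ─ w∈ys
    ws⊆ys─w v∈ws = ∈-─ w∈ys (ws⊆ys (there v∈ws)) (λ v≡w → All.lookup w∉ws v∈ws (sym v≡w))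

  length-filter-∁ : ∀ {P : A → Set} (P? : Decidable P) xs →
                    length xs ≡ length (filter P? xs) + length (filter (∁? P?) xs)
  length-filter-∁ P? []       = refl
  length-filter-∁ P? (x ∷ xs) with does (P? x)
  ... | true  = cong suc (length-filter-∁ P? xs)
  ... | false = trans (cong suc (length-filter-∁ P? xs)) (sym (+-suc _ _))

  take⊆ : ∀ n (xs : List A) → take n xs ⊆ xs
  take⊆ n xs = subst (take n xs ⊆_) (take++drop≡id n xs) (xs⊆xs++ys (take n xs) (drop n xs))

length≤length-concat : ∀ {w : Str} {xs} → w ∈ xs → length w ≤ length (concat xs)
length≤length-concat {xs = x ∷ xs} (here refl)  = length-++-≤ˡ x
length≤length-concat {xs = x ∷ xs} (there w∈xs) =
  ≤-trans (length≤length-concat w∈xs) (length-++-≤ʳ (concat xs) {x})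

_∈ₛ?_ : ∀ w (zs : List Str) → Dec (w ∈ zs)
_∈ₛ?_ = _∈?_ (≡-dec Bool._≟_)

AtLeast-∉ : ∀ {b c ys zs} → Unique ys → CardAtMost c zs → b + c ≤ length ys → AtLeast b (_∉ zs) ys
AtLeast-∉ {b} {c} {ys} {zs} ys! |zs|≤c b+c≤|ys| =
  outside , Unique.filter⁺ _ ys! , b≤|outside| , all-filter _ ys , filter-⊆ _ ys
  where
  inside outside : List Str
  inside  = filter (_∈ₛ? zs) ys
  outside = filter (∁? (_∈ₛ? zs)) ys
  |inside|≤c : length inside ≤ c
  |inside|≤c = |zs|≤c inside (Unique.filter⁺ _ ys!) (All.lookup (all-filter _ ys))
  b≤|outside| : b ≤ length outside
  b≤|outside| = +-cancelʳ-≤ c b (length outside) (begin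
    b + c                          ≤⟨ b+c≤|ys| ⟩
    length ys                      ≡⟨ length-filter-∁ (_∈ₛ? zs) ys ⟩
    length inside + length outside ≤⟨ +-monoˡ-≤ (length outside) |inside|≤c ⟩
    c + length outside             ≡⟨ +-comm c (length outside) ⟩
    length outside + c             ∎)
    where open ≤-Reasoning

AtLeast-mono : ∀ {k} {P Q : Language} {S} → (∀ {w} → w ∈ S → P w → Q w) → AtLeast k P S → AtLeast k Q S
AtLeast-mono P⇒Q (ws , ws! , k≤|ws| , Pws , ws⊆S) =
  ws , ws! , k≤|ws| , All.tabulate (λ w∈ws → P⇒Q (ws⊆S w∈ws) (All.lookup Pws w∈ws)) , ws⊆S

AtLeast-witness : ∀ {k} {P : Language} {S} → 1 ≤ k → AtLeast k P S → ∃[ w ] w ∈ S × P w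
AtLeast-witness 1≤k ([] , _ , k≤0 , _ , _)                = contradiction (≤-trans 1≤k k≤0) λ ()
AtLeast-witness _   (w ∷ _ , _ , _ , Pw ∷ _ , ws⊆S) = w , ws⊆S (here refl) , Pw

<ₗ-trans : ∀ {u v w} → u <ₗ v → v <ₗ w → u <ₗ w
<ₗ-trans []<∷      0<1       = []<∷
<ₗ-trans []<∷      (tail< _) = []<∷
<ₗ-trans 0<1       (tail< _) = 0<1
<ₗ-trans (tail< _) 0<1       = 0<1
<ₗ-trans (tail< p) (tail< q) = tail< (<ₗ-trans p q)

<ₗ-irrefl : ∀ {u} → ¬ u <ₗ u
<ₗ-irrefl (tail< p) = <ₗ-irrefl p

tail<⁻¹ : ∀ {a u v} → (a ∷ u) <ₗ (a ∷ v) → u <ₗ v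
tail<⁻¹ (tail< p) = p

∷-tri : ∀ {a u v} → Tri (u <ₗ v) (u ≡ v) (v <ₗ u) →
        Tri ((a ∷ u) <ₗ (a ∷ v)) (a ∷ u ≡ a ∷ v) ((a ∷ v) <ₗ (a ∷ u))
∷-tri (tri< p ¬e ¬q) = tri< (tail< p) (¬e ∘ ∷-injectiveʳ) (¬q ∘ tail<⁻¹)
∷-tri (tri≈ ¬p e ¬q) = tri≈ (¬p ∘ tail<⁻¹) (cong (_ ∷_) e) (¬q ∘ tail<⁻¹)
∷-tri (tri> ¬p ¬e q) = tri> (¬p ∘ tail<⁻¹) (¬e ∘ ∷-injectiveʳ) (tail< q)

<ₗ-cmp : Trichotomous _≡_ _<ₗ_
<ₗ-cmp []          []          = tri≈ (λ ()) refl (λ ())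
<ₗ-cmp []          (_ ∷ _)     = tri< []<∷ (λ ()) (λ ())
<ₗ-cmp (_ ∷ _)     []          = tri> (λ ()) (λ ()) []<∷
<ₗ-cmp (false ∷ u) (true ∷ v)  = tri< 0<1 (λ ()) (λ ())
<ₗ-cmp (true ∷ u)  (false ∷ v) = tri> (λ ()) (λ ()) 0<1
<ₗ-cmp (false ∷ u) (false ∷ v) = ∷-tri (<ₗ-cmp u v)
<ₗ-cmp (true ∷ u)  (true ∷ v)  = ∷-tri (<ₗ-cmp u v)

Linked<ₗ⇒Unique : ∀ {ws} → Linked _<ₗ_ ws → Unique ws
Linked<ₗ⇒Unique = AllPairs.map (λ { u<v refl → <ₗ-irrefl u<v }) ∘ Linked⇒AllPairs <ₗ-trans

insert : Str → List Str → List Str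
insert w []       = w ∷ []
insert w (y ∷ ys) with <ₗ-cmp w y
... | tri< _ _ _ = w ∷ y ∷ ys
... | tri≈ _ _ _ = y ∷ ys
... | tri> _ _ _ = y ∷ insert w ys

insert-linked-∷ : ∀ {w y ys} → y <ₗ w → Linked _<ₗ_ (y ∷ ys) → Linked _<ₗ_ (y ∷ insert w ys)
insert-linked-∷ {ys = []}         y<w _               = y<w ∷ [-]
insert-linked-∷ {w} {ys = z ∷ zs} y<w (y<z ∷ z∷zs↑) with <ₗ-cmp w z
... | tri< w<z _ _ = y<w ∷ w<z ∷ z∷zs↑
... | tri≈ _ _ _   = y<z ∷ z∷zs↑
... | tri> _ _ z<w = y<z ∷ insert-linked-∷ z<w z∷zs↑

insert-linked : ∀ {w ys} → Linked _<ₗ_ ys → Linked _<ₗ_ (insert w ys)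
insert-linked {ys = []}     _ = [-]
insert-linked {w} {y ∷ ys} ys↑ with <ₗ-cmp w y
... | tri< w<y _ _ = w<y ∷ ys↑
... | tri≈ _ _ _   = ys↑
... | tri> _ _ y<w = insert-linked-∷ y<w ys↑

insert-length : ∀ {w ys} → w ∉ ys → length (insert w ys) ≡ suc (length ys)
insert-length {ys = []}     _    = refl
insert-length {w} {y ∷ ys} w∉ys with <ₗ-cmp w y
... | tri< _ _ _   = refl
... | tri≈ _ w≡y _ = contradiction (here w≡y) w∉ys
... | tri> _ _ _   = cong suc (insert-length (w∉ys ∘ there))

insert-All : ∀ {P : Language} {w ys} → P w → All P ys → All P (insert w ys)
insert-All {ys = []}        Pw _          = Pw ∷ []
insert-All {w = w} {y ∷ ys} Pw (Py ∷ Pys) with <ₗ-cmp w y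
... | tri< _ _ _ = Pw ∷ Py ∷ Pys
... | tri≈ _ _ _ = Py ∷ Pys
... | tri> _ _ _ = Py ∷ insert-All Pw Pys

module _ {L : Language} (L-infinite : Infinite L) where
  open RawMonad (¬¬-Monad {0ℓ})

  fresh-member : ∀ xs → ¬ ¬ (∃[ w ] L w × w ∉ xs)
  fresh-member xs no-fresh =
    L-infinite (xs , λ w Lw → decidable-stable (w ∈ₛ? xs) (λ w∉xs → no-fresh (w , Lw , w∉xs)))

  sorted-sample : ∀ k → ¬ ¬ (∃[ ys ] Linked _<ₗ_ ys × All L ys × length ys ≡ k)
  sorted-sample zero    = pure ([] , [] , [] , refl)
  sorted-sample (suc k) = do
    ys , ys↑ , Lys , |ys|≡k ← sorted-sample k
    w , Lw , w∉ys ← fresh-member ys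
    pure (insert w ys , insert-linked ys↑ , insert-All Lw Lys , trans (insert-length w∉ys) (cong suc |ys|≡k))

  GC-infinite⇒d≤b×d≤c : ∀ {b c d} → 1 ≤ b → GC b c d L → ¬ ¬ (d ≤ b × d ≤ c)
  GC-infinite⇒d≤b×d≤c {b} {c} {d} 1≤b (_ , _ , select) = do
    ys , ys↑ , Lys , |ys|≡b ← sorted-sample b
    let _ , _ , zs⊆ys , |zs|≤c , enough = select ys (nonempty |ys|≡b) ys↑
        ws , ws! , d≤|ws| , _ , ws⊆zs =
          enough (ys , Linked<ₗ⇒Unique ys↑ , ≤-reflexive (sym |ys|≡b) , Lys , id)
    pure ( ≤-trans d≤|ws| (≤-trans (Unique-⊆⇒length≤ ws! (zs⊆ys ∘ ws⊆zs)) (≤-reflexive |ys|≡b))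
         , ≤-trans d≤|ws| (|zs|≤c ws ws! ws⊆zs))
    where
    nonempty : ∀ {ys : List Str} → length ys ≡ b → ys ≢ []
    nonempty |ys|≡b refl = contradiction (subst (1 ≤_) (sym |ys|≡b) 1≤b) λ ()

module _ (M : TM) where

  data Steps : ℕ → Config M → Config M → Set where
    []  : ∀ {c} → Steps 0 c c
    _∷_ : ∀ {n c c′ c″} → step M c ≡ just c′ → Steps n c′ c″ → Steps (suc n) c c″

  module _ {c : Config M} where

    runFor-halted : ∀ t → step M c ≡ nothing → runFor M t c ≡ just c
    runFor-halted t halts rewrite halts = refl

    runFor-zero-busy : ∀ {c′} → step M c ≡ just c′ → runFor M 0 c ≡ nothing
    runFor-zero-busy moves rewrite moves = refl

    runFor-suc-busy : ∀ {t c′} → step M c ≡ just c′ → runFor M (suc t) c ≡ runFor M t c′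
    runFor-suc-busy moves rewrite moves = refl

  runFor-Steps : ∀ {n t c c′} → Steps n c c′ → step M c′ ≡ nothing → n ≤ t → runFor M t c ≡ just c′
  runFor-Steps {t = t} []           halts _         = runFor-halted t halts
  runFor-Steps         (c→ ∷ steps) halts (s≤s n≤t) = trans (runFor-suc-busy c→) (runFor-Steps steps halts n≤t)

  perform : List (Sym M) → List (Sym M) → Fin (suc (TM.nstates M)) × Sym M × Move → Config M
  perform l r (q′ , h′ , m) = doMove M m q′ l h′ r

  step-cfg : ∀ q l h r → step M (cfg q l h r) ≡ Maybe.map (perform l r) (TM.δ M q h)
  step-cfg q l h r with TM.δ M q h
  ... | nothing = refl
  ... | just _  = refl

infixr 5 _++ˢ_
_++ˢ_ : ∀ {M m n c c′ c″} → Steps M m c c′ → Steps M n c′ c″ → Steps M (m + n) c c″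
[]           ++ˢ steps′ = steps′
(c→ ∷ steps) ++ˢ steps′ = c→ ∷ (steps ++ˢ steps′)

module TakeMachine (D : ℕ) where

  -- The scanner reads the doubled-bit encoding pair by pair: boundary i sits before a pair with
  -- i strings still to keep, inside a k has read the first bit a of a pair.  The separator 01
  -- completes a string, so it is the only pair that decrements the counter.
  data Scan : Set where
    boundary : Fin (suc D) → Scan
    inside   : Bool → Fin D → Scan

  next : Scan → Bool → Maybe Scan
  next (boundary zero)    _     = nothing
  next (boundary (suc k)) a     = just (inside a k)
  next (inside false k)   false = just (boundary (suc k))
  next (inside false k)   true  = just (boundary (inject₁ k))
  next (inside true k)    _     = just (boundary (suc k))

  start : Scan
  start = boundary (fromℕ D)

  kept : Scan → Str → Str
  kept s []      = []
  kept s (a ∷ w) with next s a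
  ... | nothing = []
  ... | just s′ = a ∷ kept s′ w

  kept-length : ∀ s w → length (kept s w) ≤ length w
  kept-length s []      = z≤n
  kept-length s (a ∷ w) with next s a
  ... | nothing = z≤n
  ... | just s′ = s≤s (kept-length s′ w)

  data State : Set where
    scanning  : Scan → State
    returning : State
    halted    : State

  lastState : ℕ
  lastState = D + (D + (D + 2))

  Q : Set
  Q = Fin (suc lastState)

  -- Taking the opposite puts the start state boundary (fromℕ D) at index zero, the initial state of a TM.
  code : State → Q
  code (scanning (boundary i))     = opposite i ↑ˡ _
  code (scanning (inside false k)) = suc D ↑ʳ (k ↑ˡ _)
  code (scanning (inside true k))  = suc D ↑ʳ (D ↑ʳ (k ↑ˡ _))
  code returning                   = suc D ↑ʳ (D ↑ʳ (D ↑ʳ zero))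
  code halted                      = suc D ↑ʳ (D ↑ʳ (D ↑ʳ suc zero))

  decode : Q → State
  decode q with splitAt (suc D) q
  ... | inj₁ i = scanning (boundary (opposite i))
  ... | inj₂ q′ with splitAt D q′
  ... | inj₁ k = scanning (inside false k)
  ... | inj₂ q″ with splitAt D q″
  ... | inj₁ k       = scanning (inside true k)
  ... | inj₂ zero    = returning
  ... | inj₂ (suc _) = halted

  decode-code : ∀ s → decode (code s) ≡ s
  decode-code (scanning (boundary i))
    rewrite splitAt-↑ˡ (suc D) (opposite i) (D + (D + 2)) | opposite-involutive i = refl
  decode-code (scanning (inside false k))
    rewrite splitAt-↑ʳ (suc D) (D + (D + 2)) (k ↑ˡ (D + 2)) | splitAt-↑ˡ D k (D + 2) = refl
  decode-code (scanning (inside true k))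
    rewrite splitAt-↑ʳ (suc D) (D + (D + 2)) (D ↑ʳ (k ↑ˡ 2)) | splitAt-↑ʳ D (D + 2) (k ↑ˡ 2)
          | splitAt-↑ˡ D k 2 = refl
  decode-code returning
    rewrite splitAt-↑ʳ (suc D) (D + (D + 2)) (D ↑ʳ (D ↑ʳ zero)) | splitAt-↑ʳ D (D + 2) (D ↑ʳ zero)
          | splitAt-↑ʳ D 2 zero = refl
  decode-code halted
    rewrite splitAt-↑ʳ (suc D) (D + (D + 2)) (D ↑ʳ (D ↑ʳ suc zero)) | splitAt-↑ʳ D (D + 2) (D ↑ʳ suc zero)
          | splitAt-↑ʳ D 2 (suc zero) = refl

  Action : Set
  Action = Maybe (State × Fin 3 × Move)

  -- Blank out the current cell, so that the output ends here, and walk back to the left end.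
  cut : Action
  cut = just (returning , zero , left)

  continue-or-cut : Maybe Scan → Fin 3 → Action
  continue-or-cut (just s) h = just (scanning s , h , right)
  continue-or-cut nothing  _ = cut

  transition : State → Fin 3 → Action
  transition (scanning s) zero               = cut
  transition (scanning s) h@(suc zero)       = continue-or-cut (next s false) h
  transition (scanning s) h@(suc (suc zero)) = continue-or-cut (next s true) h
  transition returning    zero               = just (halted , zero , right)
  transition returning    h@(suc _)          = just (returning , h , left)
  transition halted       _                  = nothing

  machine : TM
  machine = record
    { nstates = lastState
    ; extra   = 0
    ; δ       = λ q h → Maybe.map (λ (s , h′ , m) → code s , h′ , m) (transition (decode q) h)
    }

  bits : Str → List (Fin 3)
  bits = map (bitSym machine)

  at : Q → List (Fin 3) → Str → Config machine
  at q l []      = cfg q l zero []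
  at q l (a ∷ w) = cfg q l (bitSym machine a) (bits w)

  initial-at : ∀ x → initial machine x ≡ at zero [] x
  initial-at []      = refl
  initial-at (_ ∷ _) = refl

  moveRight-at : ∀ q l a w → doMove machine right q l (bitSym machine a) (bits w) ≡ at q (bitSym machine a ∷ l) w
  moveRight-at q l a []      = refl
  moveRight-at q l a (_ ∷ _) = refl

  move : ∀ {q s s′ h h′ m l r} → decode q ≡ s → transition s h ≡ just (s′ , h′ , m) →
         Steps machine 1 (cfg q l h r) (doMove machine m (code s′) l h′ r)
  move {q} {s′ = s′} {h} {h′} {m} {l} {r} refl t≡ = step≡ ∷ []
    where
    step≡ : step machine (cfg q l h r) ≡ just (doMove machine m (code s′) l h′ r)
    step≡ rewrite t≡ = refl

  halted-stuck : ∀ l h r → step machine (cfg (code halted) l h r) ≡ nothing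
  halted-stuck l h r rewrite decode-code halted = refl

  transition-scanning-bit : ∀ s a →
    transition (scanning s) (bitSym machine a) ≡ continue-or-cut (next s a) (bitSym machine a)
  transition-scanning-bit s false = refl
  transition-scanning-bit s true  = refl

  transition-returning-bit : ∀ a → transition returning (bitSym machine a) ≡ just (returning , bitSym machine a , left)
  transition-returning-bit false = refl
  transition-returning-bit true  = refl

  scan : ∀ {q} s u w → decode q ≡ scanning s →
         ∃[ r ] Steps machine (suc (length (kept s w))) (at q (bits u) w)
                              (doMove machine left (code returning) (bits (kept s w ʳ++ u)) zero r)
  scan s u []      q↦s = [] , move q↦s refl
  scan s u (a ∷ w) q↦s with next s a | transition-scanning-bit s a
  ... | nothing | t≡ = bits w , move q↦s t≡
  ... | just s′ | t≡ =
    let r , steps = scan s′ (a ∷ u) w (decode-code (scanning s′))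
    in  r , subst (Steps machine 1 _) (moveRight-at _ _ a w) (move q↦s t≡) ++ˢ steps

  sweep : ∀ v a r → Steps machine (suc (length v))
    (cfg (code returning) (bits v) (bitSym machine a) r)
    (cfg (code returning) [] zero (bits v ʳ++ (bitSym machine a ∷ r)))
  sweep []      a r = move (decode-code returning) (transition-returning-bit a)
  sweep (b ∷ v) a r = move (decode-code returning) (transition-returning-bit a) ++ˢ sweep v b (bitSym machine a ∷ r)

  rewind : ∀ v r → Steps machine (length v)
    (doMove machine left (code returning) (bits v) zero r)
    (cfg (code returning) [] zero (bits v ʳ++ (zero ∷ r)))
  rewind []      r = []
  rewind (a ∷ v) r = sweep v a (zero ∷ r)

  finish : ∀ R → Steps machine 1 (cfg (code returning) [] zero R) (doMove machine right (code halted) [] zero R)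
  finish R = move (decode-code returning) refl

  halted-after-moveRight : ∀ l h R → step machine (doMove machine right (code halted) l h R) ≡ nothing
  halted-after-moveRight l h []      = halted-stuck _ _ _
  halted-after-moveRight l h (_ ∷ _) = halted-stuck _ _ _

  output-moveRight : ∀ q l h R → output machine (doMove machine right q l h R) ≡ readBits machine R
  output-moveRight q l h []      = refl
  output-moveRight q l h (_ ∷ _) = refl

  readBits-bits : ∀ w r → readBits machine (bits w ++ zero ∷ r) ≡ w
  readBits-bits []          r = refl
  readBits-bits (false ∷ w) r = cong (false ∷_) (readBits-bits w r)
  readBits-bits (true ∷ w)  r = cong (true ∷_) (readBits-bits w r)

  run-length≤ : ∀ {k k′ n} → k ≤ n → k′ ≤ n → suc k + (k′ + 1) ≤ 2 * n ^ 2 + 2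
  run-length≤ {k} {k′} {n} k≤n k′≤n = begin
    suc k + (k′ + 1)  ≤⟨ +-mono-≤ (s≤s k≤n) (+-mono-≤ k′≤n ≤-refl) ⟩
    suc n + (n + 1)   ≡⟨ twice n ⟩
    2 * n + 2         ≤⟨ +-mono-≤ (*-monoʳ-≤ 2 (n≤n^2 n)) ≤-refl ⟩
    2 * n ^ 2 + 2     ∎
    where
    open ≤-Reasoning
    twice : ∀ n → suc n + (n + 1) ≡ 2 * n + 2
    twice = solve-∀
    n≤n^2 : ∀ n → n ≤ n ^ 2
    n≤n^2 zero    = z≤n
    n≤n^2 (suc n) = m≤m*n (suc n) (suc n ^ 1)

  take-computes : ComputesIn machine (λ n → 2 * n ^ 2 + 2) (kept start)
  take-computes x = doMove machine right (code halted) [] zero R , runs , outputs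
    where
    K : Str
    K = kept start x
    scanned : ∃[ r ] Steps machine (suc (length K)) (at zero [] x)
                                   (doMove machine left (code returning) (bits (K ʳ++ [])) zero r)
    scanned = scan start [] x refl
    r : List (Fin 3)
    r = proj₁ scanned
    R : List (Fin 3)
    R = bits (K ʳ++ []) ʳ++ (zero ∷ r)
    R≡ : R ≡ bits K ++ zero ∷ r
    R≡ = trans (cong (_ʳ++ (zero ∷ r)) (map-ʳ++ (bitSym machine) K)) (ʳ++-ʳ++ (bits K))
    runs : runFor machine (2 * length x ^ 2 + 2) (initial machine x) ≡ just (doMove machine right (code halted) [] zero R)
    runs rewrite initial-at x =
      runFor-Steps machine (proj₂ scanned ++ˢ rewind (K ʳ++ []) r ++ˢ finish R)
        (halted-after-moveRight [] zero R)
        (run-length≤ (kept-length start x)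
          (≤-trans (≤-reflexive (trans (length-ʳ++ K) (+-identityʳ _))) (kept-length start x)))
    outputs : output machine (doMove machine right (code halted) [] zero R) ≡ K
    outputs = trans (output-moveRight _ [] zero R) (trans (cong (readBits machine) R≡) (readBits-bits K r))

encString : Str → Str
encString y = concatMap (λ a → a ∷ a ∷ []) y ++ false ∷ true ∷ []

module _ {D : ℕ} where
  open TakeMachine D

  kept-boundary-zero : ∀ w → kept (boundary zero) w ≡ []
  kept-boundary-zero []      = refl
  kept-boundary-zero (_ ∷ _) = refl

  kept-encString : ∀ k y w → kept (boundary (suc k)) (encString y ++ w) ≡ encString y ++ kept (boundary (inject₁ k)) w
  kept-encString k []          w = refl
  kept-encString k (false ∷ y) w = cong (λ v → false ∷ false ∷ v) (kept-encString k y w)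
  kept-encString k (true ∷ y)  w = cong (λ v → true ∷ true ∷ v) (kept-encString k y w)

  kept-encTuple : ∀ i ys → kept (boundary i) (encTuple ys) ≡ encTuple (take (toℕ i) ys)
  kept-encTuple zero    ys       = kept-boundary-zero (encTuple ys)
  kept-encTuple (suc k) []       = refl
  kept-encTuple (suc k) (y ∷ ys) = begin
    kept (boundary (suc k)) (encString y ++ encTuple ys)     ≡⟨ kept-encString k y (encTuple ys) ⟩
    encString y ++ kept (boundary (inject₁ k)) (encTuple ys) ≡⟨ cong (encString y ++_) (kept-encTuple (inject₁ k) ys) ⟩
    encString y ++ encTuple (take (toℕ (inject₁ k)) ys)
      ≡⟨ cong (λ n → encString y ++ encTuple (take n ys)) (toℕ-inject₁ k) ⟩
    encString y ++ encTuple (take (toℕ k) ys)                ∎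
    where open ≡-Reasoning

  kept-start : ∀ ys → kept start (encTuple ys) ≡ encTuple (take D ys)
  kept-start ys = trans (kept-encTuple _ ys) (cong (λ n → encTuple (take n ys)) (toℕ-fromℕ D))

decAux-pair : ∀ a acc r → decAux acc (a ∷ a ∷ r) ≡ decAux (a ∷ acc) r
decAux-pair false []      r = refl
decAux-pair false (_ ∷ _) r = refl
decAux-pair true  []      r = refl
decAux-pair true  (_ ∷ _) r = refl

decAux-separator : ∀ acc r → decAux acc (false ∷ true ∷ r) ≡ Maybe.map ((acc ʳ++ []) ∷_) (decAux [] r)
decAux-separator []      r = refl
decAux-separator (_ ∷ _) r = refl

decAux-encString : ∀ acc y r → decAux acc (encString y ++ r) ≡ Maybe.map ((acc ʳ++ y) ∷_) (decAux [] r)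
decAux-encString acc []      r = decAux-separator acc r
decAux-encString acc (a ∷ y) r = trans (decAux-pair a acc _) (decAux-encString (a ∷ acc) y r)

decTuple-encTuple : ∀ zs → decTuple (encTuple zs) ≡ just zs
decTuple-encTuple []       = refl
decTuple-encTuple (z ∷ zs) =
  trans (decAux-encString [] z (encTuple zs)) (cong (Maybe.map (z ∷_)) (decTuple-encTuple zs))

module _ {b c d : ℕ} (d≤b : d ≤ b) (d≤c : d ≤ c) where

  take-CardAtMost : ∀ ys → CardAtMost c (take d ys)
  take-CardAtMost ys ws ws! ws⊆ = begin
    length ws           ≤⟨ Unique-⊆⇒length≤ ws! ws⊆ ⟩
    length (take d ys)  ≡⟨ length-take d ys ⟩
    d ⊓ length ys       ≤⟨ m⊓n≤m d (length ys) ⟩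
    d                   ≤⟨ d≤c ⟩
    c                   ∎
    where open ≤-Reasoning

  take-AtLeast : ∀ {ys} → Linked _<ₗ_ ys → AtLeast b U ys → AtLeast d U (take d ys)
  take-AtLeast {ys} ys↑ (ws , ws! , b≤|ws| , _ , ws⊆ys) =
    take d ys , Unique.take⁺ d (Linked<ₗ⇒Unique ys↑) , ≤-reflexive (sym |take|≡d) , All.universal _ _ , id
    where
    |take|≡d : length (take d ys) ≡ d
    |take|≡d = trans (length-take d ys)
      (m≤n⇒m⊓n≡m (≤-trans d≤b (≤-trans b≤|ws| (Unique-⊆⇒length≤ ws! ws⊆ys))))

  U∈GC : GC b c d U
  U∈GC = kept start , (machine , 2 , take-computes) , λ ys _ ys↑ →
    take d ys , trans (cong decTuple (kept-start ys)) (decTuple-encTuple (take d ys))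
              , take⊆ d ys , take-CardAtMost ys , take-AtLeast ys↑
    where open TakeMachine d

U-infinite : Infinite U
U-infinite (xs , covers) = 1+n≰n (length≤length-concat (covers (true ∷ concat xs) tt))

next-on-diagonal : ℕ × ℕ → ℕ × ℕ
next-on-diagonal (a , zero)  = 0 , suc a
next-on-diagonal (a , suc b) = suc a , b

unpair : ℕ → ℕ × ℕ
unpair zero    = 0 , 0
unpair (suc n) = next-on-diagonal (unpair n)

unpair-reaches : ∀ s a b → a + b ≤ s → ∃[ n ] unpair n ≡ (a , b)
unpair-reaches s       (suc a) b       a+b≤s
  with unpair-reaches s a (suc b) (≤-trans (≤-reflexive (+-suc a b)) a+b≤s)
... | n , unpair-n≡ = suc n , cong next-on-diagonal unpair-n≡
unpair-reaches s       zero    zero    _     = 0 , refl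
unpair-reaches (suc s) zero    (suc b) (s≤s b≤s)
  with unpair-reaches s b zero (≤-trans (≤-reflexive (+-identityʳ b)) b≤s)
... | n , unpair-n≡ = suc n , cong next-on-diagonal unpair-n≡

unpair-surjective : StrictlySurjective _≡_ unpair
unpair-surjective (a , b) = unpair-reaches (a + b) a b ≤-refl

module _ {A B : Set} where

  enum-× : (ℕ → A) → (ℕ → B) → ℕ → A × B
  enum-× e₁ e₂ = Product.map e₁ e₂ ∘ unpair

  enum-×-surjective : ∀ {e₁ e₂} → StrictlySurjective _≡_ e₁ → StrictlySurjective _≡_ e₂ →
                      StrictlySurjective _≡_ (enum-× e₁ e₂)
  enum-×-surjective surj₁ surj₂ (a , b)
    with i , e₁i≡a ← surj₁ a
    with j , e₂j≡b ← surj₂ b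
    with n , unpair-n≡ ← unpair-surjective (i , j)
    = n , trans (cong (Product.map _ _) unpair-n≡) (cong₂ _,_ e₁i≡a e₂j≡b)

module _ {A : Set} where

  enum-Maybe : (ℕ → A) → ℕ → Maybe A
  enum-Maybe e zero    = nothing
  enum-Maybe e (suc n) = just (e n)

  enum-Maybe-surjective : ∀ {e} → StrictlySurjective _≡_ e → StrictlySurjective _≡_ (enum-Maybe e)
  enum-Maybe-surjective surj nothing  = 0 , refl
  enum-Maybe-surjective surj (just a) = Product.map suc (cong just) (surj a)

  enum-→ : ∀ n → (ℕ → A) → ℕ → (Fin n → A)
  enum-→ (suc n) e k zero    = e (proj₁ (unpair k))
  enum-→ (suc n) e k (suc i) = enum-→ n e (proj₂ (unpair k)) i

  enum-→-surjective : ∀ {_≈_ : A → A → Set} {e} n → StrictlySurjective _≈_ e →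
                      StrictlySurjective (λ f g → ∀ i → f i ≈ g i) (enum-→ n e)
  enum-→-surjective zero    surj f = 0 , λ ()
  enum-→-surjective {_≈_} {e} (suc n) surj f
    with i , ei≈f0 ← surj (f zero)
    with j , rest≈ ← enum-→-surjective {_≈_ = _≈_} {e} n surj (f ∘ suc)
    with k , unpair-k≡ ← unpair-surjective (i , j)
    = k , λ { zero    → subst (λ p → e (proj₁ p) ≈ f zero) (sym unpair-k≡) ei≈f0
            ; (suc x) → subst (λ p → enum-→ n e (proj₂ p) x ≈ f (suc x)) (sym unpair-k≡) (rest≈ x) }

enum-Fin : ∀ n → ℕ → Fin (suc n)
enum-Fin n       zero    = zero
enum-Fin zero    (suc k) = zero
enum-Fin (suc n) (suc k) = suc (enum-Fin n k)

enum-Fin-surjective : ∀ n → StrictlySurjective _≡_ (enum-Fin n)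
enum-Fin-surjective n       zero    = 0 , refl
enum-Fin-surjective (suc n) (suc i) = Product.map suc (cong suc) (enum-Fin-surjective n i)

enum-Move : ℕ → Move
enum-Move 0 = left
enum-Move 1 = right
enum-Move _ = stay

enum-Move-surjective : StrictlySurjective _≡_ enum-Move
enum-Move-surjective left  = 0 , refl
enum-Move-surjective right = 1 , refl
enum-Move-surjective stay  = 2 , refl

Transitions : ℕ → ℕ → Set
Transitions a b = Fin (suc a) → Fin (3 + b) → Maybe (Fin (suc a) × Fin (3 + b) × Move)

machineWith : (a b : ℕ) → Transitions a b → TM
machineWith a b δ = record { nstates = a ; extra = b ; δ = δ }

enum-Transitions : ∀ a b → ℕ → Transitions a b
enum-Transitions a b =
  enum-→ (suc a) (enum-→ (3 + b) (enum-Maybe (enum-× (enum-Fin a) (enum-× (enum-Fin (2 + b)) enum-Move))))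

enum-Transitions-surjective : ∀ a b →
  StrictlySurjective (λ δ δ′ → ∀ q h → δ q h ≡ δ′ q h) (enum-Transitions a b)
enum-Transitions-surjective a b =
  enum-→-surjective {_≈_ = λ f g → ∀ h → f h ≡ g h} (suc a) (enum-→-surjective {_≈_ = _≡_} (3 + b)
    (enum-Maybe-surjective (enum-×-surjective (enum-Fin-surjective a)
      (enum-×-surjective (enum-Fin-surjective (2 + b)) enum-Move-surjective))))

toClockedTM : ℕ × ℕ × ℕ × ℕ → TM × ℕ
toClockedTM (a , b , i , k) = machineWith a b (enum-Transitions a b i) , k

enum-ℕ⁴ : ℕ → ℕ × ℕ × ℕ × ℕ
enum-ℕ⁴ = enum-× id (enum-× id (enum-× id id))

enum-ℕ⁴-surjective : StrictlySurjective _≡_ enum-ℕ⁴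
enum-ℕ⁴-surjective = enum-×-surjective (_, refl) (enum-×-surjective (_, refl) (enum-×-surjective (_, refl) (_, refl)))

enum-ClockedTM : ℕ → TM × ℕ
enum-ClockedTM = toClockedTM ∘ enum-ℕ⁴

clockedOutput : TM × ℕ → Str → Maybe Str
clockedOutput (M , k) x = Maybe.map (output M) (runFor M (k * length x ^ k + k) (initial M x))

computes⇒clockedOutput : ∀ {M k f} → ComputesIn M (λ n → k * n ^ k + k) f →
                         ∀ x → clockedOutput (M , k) x ≡ just (f x)
computes⇒clockedOutput computes x with computes x
... | c , runs , outputs = trans (cong (Maybe.map _) runs) (cong just outputs)

-- Machines differing only in δ have configurations with the same fields but of different types.
module _ {a b : ℕ} {δ₁ δ₂ : Transitions a b} (δ₁≗δ₂ : ∀ q h → δ₁ q h ≡ δ₂ q h) where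

  private
    M₁ M₂ : TM
    M₁ = machineWith a b δ₁
    M₂ = machineWith a b δ₂

  transport : Config M₁ → Config M₂
  transport (cfg q l h r) = cfg q l h r

  doMove-transport : ∀ m q l h r → doMove M₂ m q l h r ≡ transport (doMove M₁ m q l h r)
  doMove-transport left  q []      h r       = refl
  doMove-transport left  q (_ ∷ _) h r       = refl
  doMove-transport right q l       h []      = refl
  doMove-transport right q l       h (_ ∷ _) = refl
  doMove-transport stay  q l       h r       = refl

  step-transport : ∀ c → step M₂ (transport c) ≡ Maybe.map transport (step M₁ c)
  step-transport (cfg q l h r) = begin
    step M₂ (cfg q l h r)                                     ≡⟨ step-cfg M₂ q l h r ⟩
    Maybe.map (perform M₂ l r) (δ₂ q h)                       ≡⟨ cong (Maybe.map _) (sym (δ₁≗δ₂ q h)) ⟩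
    Maybe.map (perform M₂ l r) (δ₁ q h)
      ≡⟨ Maybe.map-cong (λ (q′ , h′ , m) → doMove-transport m q′ l h′ r) (δ₁ q h) ⟩
    Maybe.map (transport ∘ perform M₁ l r) (δ₁ q h)           ≡⟨ Maybe.map-∘ (δ₁ q h) ⟩
    Maybe.map transport (Maybe.map (perform M₁ l r) (δ₁ q h)) ≡⟨ cong (Maybe.map transport) (step-cfg M₁ q l h r) ⟨
    Maybe.map transport (step M₁ (cfg q l h r))               ∎
    where open ≡-Reasoning

  runFor-transport : ∀ t c → runFor M₂ t (transport c) ≡ Maybe.map transport (runFor M₁ t c)
  runFor-transport t c = go t c refl
    where
    -- A `with` on step M₁ c would be ill-typed: Agda eta-contracts transport c to c.
    step₂ : ∀ {c s} → step M₁ c ≡ s → step M₂ (transport c) ≡ Maybe.map transport s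
    step₂ {c} step≡ = trans (step-transport c) (cong (Maybe.map transport) step≡)
    go : ∀ t c {s} → step M₁ c ≡ s → runFor M₂ t (transport c) ≡ Maybe.map transport (runFor M₁ t c)
    go t       c {nothing} halts = trans (runFor-halted M₂ t (step₂ halts))
                                         (cong (Maybe.map transport) (sym (runFor-halted M₁ t halts)))
    go zero    c {just _}  moves = trans (runFor-zero-busy M₂ (step₂ moves))
                                         (cong (Maybe.map transport) (sym (runFor-zero-busy M₁ moves)))
    go (suc t) c {just c′} moves = trans (runFor-suc-busy M₂ (step₂ moves))
                                    (trans (go t c′ refl) (cong (Maybe.map transport) (sym (runFor-suc-busy M₁ moves))))

  bitSym-transport : ∀ x → bitSym M₂ x ≡ bitSym M₁ x
  bitSym-transport false = refl
  bitSym-transport true  = refl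

  initial-transport : ∀ x → initial M₂ x ≡ transport (initial M₁ x)
  initial-transport []      = refl
  initial-transport (x ∷ w) = cong₂ (cfg zero []) (bitSym-transport x) (map-cong bitSym-transport w)

  readBits-transport : ∀ s → readBits M₂ s ≡ readBits M₁ s
  readBits-transport []                    = refl
  readBits-transport (zero ∷ _)            = refl
  readBits-transport (suc zero ∷ s)        = cong (false ∷_) (readBits-transport s)
  readBits-transport (suc (suc zero) ∷ s)  = cong (true ∷_) (readBits-transport s)
  readBits-transport (suc (suc (suc _)) ∷ _) = refl

  output-transport : ∀ c → output M₂ (transport c) ≡ output M₁ c
  output-transport (cfg q l h r) = readBits-transport (h ∷ r)

  clockedOutput-transport : ∀ k x → clockedOutput (M₂ , k) x ≡ clockedOutput (M₁ , k) x
  clockedOutput-transport k x = begin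
    Maybe.map (output M₂) (runFor M₂ t (initial M₂ x))             ≡⟨ cong (Maybe.map (output M₂) ∘ runFor M₂ t) (initial-transport x) ⟩
    Maybe.map (output M₂) (runFor M₂ t (transport (initial M₁ x))) ≡⟨ cong (Maybe.map (output M₂)) (runFor-transport t (initial M₁ x)) ⟩
    Maybe.map (output M₂) (Maybe.map transport run₁)               ≡⟨ Maybe.map-∘ run₁ ⟨
    Maybe.map (output M₂ ∘ transport) run₁                         ≡⟨ Maybe.map-cong output-transport run₁ ⟩
    Maybe.map (output M₁) run₁                                     ∎
    where
    open ≡-Reasoning
    t : ℕ
    t = k * length x ^ k + k
    run₁ : Maybe (Config M₁)
    run₁ = runFor M₁ t (initial M₁ x)

enum-ClockedTM-complete : ∀ M k → ∃[ n ] ∀ x → clockedOutput (enum-ClockedTM n) x ≡ clockedOutput (M , k) x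
enum-ClockedTM-complete M k
  with i , δᵢ≗δ ← enum-Transitions-surjective (TM.nstates M) (TM.extra M) (TM.δ M)
  with n , enum-n≡ ← enum-ℕ⁴-surjective (TM.nstates M , TM.extra M , i , k)
  = n , λ x → trans (cong (λ p → clockedOutput (toClockedTM p) x) enum-n≡)
                    (clockedOutput-transport (λ q h → sym (δᵢ≗δ q h)) k x)

word : ℕ → ℕ → Str
word n i = replicate n true ++ false ∷ replicate i true

replicate-true-< : ∀ i → replicate i true <ₗ replicate (suc i) true
replicate-true-< zero    = []<∷
replicate-true-< (suc i) = tail< (replicate-true-< i)

word-< : ∀ n i → word n i <ₗ word n (suc i)
word-< zero    i = tail< (replicate-true-< i)
word-< (suc n) i = tail< (word-< n i)

word-injectiveˡ : ∀ n i n′ j → word n i ≡ word n′ j → n ≡ n′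
word-injectiveˡ zero    i zero     j _  = refl
word-injectiveˡ (suc n) i (suc n′) j eq = cong suc (word-injectiveˡ n i n′ j (∷-injectiveʳ eq))

module Diagonal (b c : ℕ) where

  block : ℕ → List Str
  block n = applyUpTo (word n) (b + c)

  block-linked : ∀ n → Linked _<ₗ_ (block n)
  block-linked n = applyUpTo⁺₂ (word n) (b + c) (word-< n)

  blocks-disjoint : ∀ {w n n′} → w ∈ block n → w ∈ block n′ → n ≡ n′
  blocks-disjoint w∈ w∈′ with ∈-applyUpTo⁻ _ w∈ | ∈-applyUpTo⁻ _ w∈′
  ... | i , _ , refl | j , _ , w≡ = word-injectiveˡ _ i _ j w≡

  -- [] when the n-th machine does not halt in time or its output is not a tuple.
  selection : ℕ → List Str
  selection n = fromMaybe [] (clockedOutput (enum-ClockedTM n) (encTuple (block n)) Maybe.>>= decTuple)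

  diagonal : Language
  diagonal w = ∃[ n ] w ∈ block n × w ∉ selection n

  diagonal-∉-selection : ∀ {w n} → w ∈ block n → diagonal w → w ∉ selection n
  diagonal-∉-selection w∈ (n′ , w∈′ , w∉) rewrite blocks-disjoint w∈ w∈′ = w∉

  block-nonempty : 1 ≤ b → ∀ n → block n ≢ []
  block-nonempty (s≤s _) n ()

  selection-computed : ∀ {n M k f zs} → (∀ x → clockedOutput (enum-ClockedTM n) x ≡ clockedOutput (M , k) x) →
                       ComputesIn M (λ n → k * n ^ k + k) f → decTuple (f (encTuple (block n))) ≡ just zs →
                       selection n ≡ zs
  selection-computed {n} {M} {k} {f} {zs} same-output computes decodes = cong (fromMaybe []) (begin
    (clockedOutput (enum-ClockedTM n) x Maybe.>>= decTuple) ≡⟨ cong (Maybe._>>= decTuple) (same-output x) ⟩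
    (clockedOutput (M , k) x Maybe.>>= decTuple)
      ≡⟨ cong (Maybe._>>= decTuple) (computes⇒clockedOutput {k = k} computes x) ⟩
    decTuple (f x)                                          ≡⟨ decodes ⟩
    just zs                                                 ∎)
    where
    open ≡-Reasoning
    x : Str
    x = encTuple (block n)

  selection-fails : ∀ {d} n {zs} → 1 ≤ d → selection n ≡ zs → zs ⊆ block n → CardAtMost c zs →
                    ¬ (AtLeast b diagonal (block n) → AtLeast d diagonal zs)
  selection-fails n {zs} 1≤d selection≡zs zs⊆block |zs|≤c enough =
    let w , w∈zs , w∈diagonal = AtLeast-witness 1≤d (enough outside-selection)
    in  diagonal-∉-selection (zs⊆block w∈zs) w∈diagonal (subst (w ∈_) (sym selection≡zs) w∈zs)
    where
    outside-selection : AtLeast b diagonal (block n)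
    outside-selection = AtLeast-mono (λ w∈block w∉zs → n , w∈block , subst (_ ∉_) (sym selection≡zs) w∉zs)
      (AtLeast-∉ (Linked<ₗ⇒Unique (block-linked n)) |zs|≤c (≤-reflexive (sym (length-applyUpTo _ (b + c)))))

  diagonal∉GC : ∀ {d} → 1 ≤ b → 1 ≤ d → ¬ GC b c d diagonal
  diagonal∉GC 1≤b 1≤d (f , (M , k , computes) , select) =
    let n , same-output = enum-ClockedTM-complete M k
        zs , decodes , zs⊆block , |zs|≤c , enough = select (block n) (block-nonempty 1≤b n) (block-linked n)
    in  selection-fails n 1≤d (selection-computed {k = k} same-output computes decodes) zs⊆block |zs|≤c enough

theorem4p11 : (b c d : ℕ) → 1 ≤ b → 1 ≤ c → 1 ≤ d →
    ((∀ L → GC b c d L → ¬ Infinite L) ⇔ (b < d ⊎ c < d))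
    × (d ≤ b → d ≤ c → Nontrivial (GC b c d))
theorem4p11 b c d 1≤b _ 1≤d = mk⇔ all-finite⇒d-large d-large⇒all-finite , nontrivial
  where
  all-finite⇒d-large : (∀ L → GC b c d L → ¬ Infinite L) → b < d ⊎ c < d
  all-finite⇒d-large all-finite with d ≤? b | d ≤? c
  ... | yes d≤b | yes d≤c = contradiction U-infinite (all-finite U (U∈GC d≤b d≤c))
  ... | no d≰b  | _       = inj₁ (≰⇒> d≰b)
  ... | yes _   | no d≰c  = inj₂ (≰⇒> d≰c)

  d-large⇒all-finite : b < d ⊎ c < d → ∀ L → GC b c d L → ¬ Infinite L
  d-large⇒all-finite d-large L L∈GC L-infinite = GC-infinite⇒d≤b×d≤c L-infinite 1≤b L∈GC λ (d≤b , d≤c) →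
    [ (λ b<d → <⇒≱ b<d d≤b) , (λ c<d → <⇒≱ c<d d≤c) ] d-large

  nontrivial : d ≤ b → d ≤ c → Nontrivial (GC b c d)
  nontrivial d≤b d≤c =
    (U , U∈GC d≤b d≤c , U-infinite) , λ all-in-GC → Diagonal.diagonal∉GC b c 1≤b 1≤d (all-in-GC _)
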